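{- Let $G$ be an abelian group of order $2n$, $\mathcal{E}\subset G$ a subgroup of index $2$, $\mathcal{O}=G\setminus\mathcal{E}$. For every $0\neq x\in\mathcal{E}$ we have $e(\mathcal{G}_x)\geqslant\max\{n-r(G),\,n/2\}$. Moreover, if $S\subset\mathcal{E}$ satisfies $0\notin S$ and $m(S)=0$, then $e(\mathcal{G}_S)\geqslant\sum_{x\in S}e(\mathcal{G}_x)/2$.
   Context: For $X\subset G$: $r(X)$ is the number of $x\in X$ with $x=-x$, and $m(X)$ is the number of two-element subsets $\{x,-x\}\subset X$ with $x\neq -x$. For $S\subset\mathcal{E}$, $\mathcal{G}_S$ is the graph on vertex set $\mathcal{O}$ with edges $\{y,z\}$, $y\neq z$, such that $y+z\in S$ or $y-z\in S$; $\mathcal{G}_x=\mathcal{G}_{\{x\}}$; $e(\cdot)$ is the number of edges. -}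

module Defs where

open import Data.Nat using (ℕ; zero; suc; _+_)
open import Data.Bool using (Bool; true; false; if_then_else_; _∧_; _∨_; not)
open import Data.Fin using (Fin; zero; suc; _<?_)
open import Data.Fin.Properties using (_≟_)
open import Data.Fin.Subset using (Subset; _∈_)
open import Data.Vec using (lookup)
open import Relation.Nullary.Decidable using (⌊_⌋)
open import Relation.Binary.PropositionalEquality using (_≡_)
open import Algebra.Core using (Op₁; Op₂)

count : ∀ {k} → (Fin k → Bool) → ℕ
count {zero}  f = 0
count {suc k} f = (if f zero then 1 else 0) + count (λ i → f (suc i))

sumF : ∀ {k} → (Fin k → ℕ) → ℕ
sumF {zero}  f = 0
sumF {suc k} f = f zero + sumF (λ i → f (suc i))

countPairs : ∀ {k} → (Fin k → Fin k → Bool) → ℕ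
countPairs P = sumF (λ y → count (λ z → P y z))

record IsSubgroup {N : ℕ} (_+'_ : Op₂ (Fin N)) (0g : Fin N) (-'_ : Op₁ (Fin N))
                  (E : Subset N) : Set where
  field
    zero∈ : 0g ∈ E
    +-closed : ∀ {x y} → x ∈ E → y ∈ E → (x +' y) ∈ E
    neg-closed : ∀ {x} → x ∈ E → (-' x) ∈ E

module GraphDefs {N : ℕ} (_+'_ : Op₂ (Fin N)) (-'_ : Op₁ (Fin N)) where

  _-'_ : Op₂ (Fin N)
  y -' z = y +' (-' z)

  r : Subset N → ℕ
  r X = count (λ x → lookup X x ∧ ⌊ x ≟ (-' x) ⌋)

  -- m(X): number of two-element subsets {x , -x} ⊆ X with x ≠ -x
  -- (each such set counted once, via its ordered representative x < -x)
  m : Subset N → ℕ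
  m X = countPairs (λ x y → ⌊ x <? y ⌋ ∧ ⌊ y ≟ (-' x) ⌋ ∧ lookup X x ∧ lookup X y)

  adj : Subset N → Fin N → Fin N → Bool
  adj S y z = lookup S (y +' z) ∨ lookup S (y -' z) ∨ lookup S (z -' y)

  -- e(G_S): number of edges {y , z}, y ≠ z, of the graph G_S on O = G \ E
  -- (each edge counted once, via y < z)
  e : (E S : Subset N) → ℕ
  e E S = countPairs (λ y z → ⌊ y <? z ⌋ ∧ not (lookup E y) ∧ not (lookup E z) ∧ adj S y z)

module Submission where

-- Let E be a subgroup of index 2 in the abelian group G, and call the
-- elements of O = G \ E odd.
--
-- An odd vertex y has the neighbours
-- y + x, y - x and x - y in G_x.  They are odd, differ from y (the last
-- one unless y + y = x), and y + x differs from y - x unless x = -x and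
-- from x - y unless y = -y.  Hence every odd y has degree ≥ 1 and
--   deg y + [y = -y] + [y + y = x] ≥ 2.
-- Summing over the n odd vertices, with the handshake inequality
-- Σ deg ≤ 2 e(G_x) and the bound #{y : y + y = x} ≤ r(G) (the solutions
-- form either nothing or a translate of {t : t = -t}), gives
-- 2n ≤ 2 e(G_x) + 2 r(G) and n ≤ 2 e(G_x).
--
-- Double counting: Σ_{x∈S} e(G_x) counts the pairs
-- (x , {y , z}) where {y , z} is an edge of G_S labelled by x ∈ S, i.e.
-- x ∈ {y + z, y - z, z - y}.  As z - y = -(y - z), the condition m(S) = 0
-- forbids both to be distinct elements of S, so each edge has ≤ 2 labels.
--
-- Part 2 needs only m(S) = 0.

open import Defs
open import Level using (0ℓ)
open import Data.Nat using (ℕ; zero; suc; _+_; _*_; _∸_; _≤_; z≤n; s≤s)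
open import Data.Nat.Properties as ℕP
  using (≤-trans; ≤-reflexive; +-mono-≤; m≤m+n; module ≤-Reasoning)
open import Data.Bool using (Bool; true; false; not; _∧_; _∨_; if_then_else_)
open import Data.Bool.Properties using (∧-conicalˡ; ∧-conicalʳ; ∨-comm)
open import Data.Fin using (Fin; zero; suc; _<?_)
open import Data.Fin.Properties using (_≟_; <-cmp; suc-injective)
open import Data.Fin.Subset using (Subset; _∈_; _∉_; _⊆_; ⊤; ⁅_⁆; ∣_∣)
open import Data.Fin.Subset.Properties using (∈⊤; x∈⁅x⁆; x∈⁅y⁆⇒x≡y)
open import Data.Fin.Permutation using (permutation)
open import Data.Vec using (lookup; []; _∷_)
open import Data.Vec.Properties using ([]=⇒lookup; lookup⇒[]=)
open import Data.Empty using (⊥-elim)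
open import Data.Product using (_×_; _,_; ∃)
open import Data.Sum using (_⊎_; inj₁; inj₂)
import Data.Sum as Sum
open import Function using (_∘_; id)
open import Relation.Nullary using (Dec; yes; no; ¬_)
open import Relation.Nullary.Decidable using (⌊_⌋; ⌊⌋-map′)
open import Relation.Binary.Definitions using (tri<; tri≈; tri>)
open import Relation.Binary.PropositionalEquality
  using (_≡_; _≢_; refl; sym; trans; cong; cong₂; subst; module ≡-Reasoning)
open import Algebra.Core using (Op₁; Op₂)
open import Algebra.Bundles using (AbelianGroup)
open import Algebra.Structures using (IsAbelianGroup)
import Algebra.Properties.AbelianGroup as AbelianGroupProperties
import Algebra.Properties.CommutativeSemigroup as CommutativeSemigroupProperties
import Algebra.Properties.CommutativeMonoid.Sum as CommutativeMonoidSum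

∧-intro : ∀ {a b} → a ≡ true → b ≡ true → a ∧ b ≡ true
∧-intro refl refl = refl

∧-elimˡ : ∀ a {b} → a ∧ b ≡ true → a ≡ true
∧-elimˡ a = ∧-conicalˡ a _

∧-elimʳ : ∀ a {b} → a ∧ b ≡ true → b ≡ true
∧-elimʳ a = ∧-conicalʳ a _

∨-introˡ : ∀ {a b} → a ≡ true → a ∨ b ≡ true
∨-introˡ refl = refl

∨-introʳ : ∀ a {b} → b ≡ true → a ∨ b ≡ true
∨-introʳ true  _  = refl
∨-introʳ false hb = hb

∨-elim : ∀ a {b} → a ∨ b ≡ true → a ≡ true ⊎ b ≡ true
∨-elim true  _  = inj₁ refl
∨-elim false hb = inj₂ hb

∧-swap : ∀ a b c → a ∧ (b ∧ c) ≡ b ∧ (a ∧ c)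
∧-swap true  b     c = refl
∧-swap false true  c = refl
∧-swap false false c = refl

true≢false : true ≢ false
true≢false ()

⌊⌋-true : ∀ {A : Set} (a? : Dec A) → A → ⌊ a? ⌋ ≡ true
⌊⌋-true (yes _) _ = refl
⌊⌋-true (no ¬a) a = ⊥-elim (¬a a)

⌊⌋-false : ∀ {A : Set} (a? : Dec A) → ¬ A → ⌊ a? ⌋ ≡ false
⌊⌋-false (yes a) ¬a = ⊥-elim (¬a a)
⌊⌋-false (no _)  _  = refl

⌊⌋-sound : ∀ {A : Set} (a? : Dec A) → ⌊ a? ⌋ ≡ true → A
⌊⌋-sound (yes a) _ = a

⌊⌋-cong : ∀ {A B : Set} (a? : Dec A) (b? : Dec B) → (A → B) → (B → A) → ⌊ a? ⌋ ≡ ⌊ b? ⌋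
⌊⌋-cong (yes a) b? f _ = sym (⌊⌋-true b? (f a))
⌊⌋-cong (no ¬a) b? _ g = sym (⌊⌋-false b? (¬a ∘ g))

𝟙 : Bool → ℕ
𝟙 b = if b then 1 else 0

module ΣP = CommutativeMonoidSum ℕP.+-0-commutativeMonoid
open CommutativeSemigroupProperties ℕP.+-commutativeSemigroup
  using () renaming (interchange to ℕ-interchange)

sumF-cong : ∀ {k} {f g : Fin k → ℕ} → (∀ i → f i ≡ g i) → sumF f ≡ sumF g
sumF-cong {zero}  _  = refl
sumF-cong {suc k} eq = cong₂ _+_ (eq zero) (sumF-cong (eq ∘ suc))

sumF-mono : ∀ {k} {f g : Fin k → ℕ} → (∀ i → f i ≤ g i) → sumF f ≤ sumF g
sumF-mono {zero}  _  = z≤n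
sumF-mono {suc k} le = +-mono-≤ (le zero) (sumF-mono (le ∘ suc))

sumF-zero : ∀ {k} → sumF {k} (λ _ → 0) ≡ 0
sumF-zero {zero}  = refl
sumF-zero {suc k} = sumF-zero {k}

sumF-* : ∀ {k} c (f : Fin k → ℕ) → sumF (λ i → c * f i) ≡ c * sumF f
sumF-* {zero}  c f = sym (ℕP.*-zeroʳ c)
sumF-* {suc k} c f =
  trans (cong (c * f zero +_) (sumF-* c (f ∘ suc))) (sym (ℕP.*-distribˡ-+ c (f zero) _))

term≤sumF : ∀ {k} (f : Fin k → ℕ) i → f i ≤ sumF f
term≤sumF f zero    = m≤m+n (f zero) _
term≤sumF f (suc i) = ≤-trans (term≤sumF (f ∘ suc) i) (ℕP.m≤n+m _ (f zero))

sumF≡sum : ∀ {k} (f : Fin k → ℕ) → sumF f ≡ ΣP.sum f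
sumF≡sum {zero}  f = refl
sumF≡sum {suc k} f = cong (f zero +_) (sumF≡sum (f ∘ suc))

sumF-+ : ∀ {k} (f g : Fin k → ℕ) → sumF (λ i → f i + g i) ≡ sumF f + sumF g
sumF-+ f g = trans (sumF≡sum (λ i → f i + g i))
  (trans (ΣP.∑-distrib-+ f g) (sym (cong₂ _+_ (sumF≡sum f) (sumF≡sum g))))

sumF-swap : ∀ {k l} (h : Fin k → Fin l → ℕ) →
            sumF (λ i → sumF (λ j → h i j)) ≡ sumF (λ j → sumF (λ i → h i j))
sumF-swap h = begin
  sumF (λ i → sumF (h i))              ≡⟨ sumF-cong (λ i → sumF≡sum (h i)) ⟩
  sumF (λ i → ΣP.sum (h i))            ≡⟨ sumF≡sum (λ i → ΣP.sum (h i)) ⟩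
  ΣP.sum (λ i → ΣP.sum (h i))          ≡⟨ ΣP.∑-comm h ⟩
  ΣP.sum (λ j → ΣP.sum (λ i → h i j))  ≡⟨ sym (sumF≡sum (λ j → ΣP.sum (λ i → h i j))) ⟩
  sumF (λ j → ΣP.sum (λ i → h i j))    ≡⟨ sumF-cong (λ j → sym (sumF≡sum (λ i → h i j))) ⟩
  sumF (λ j → sumF (λ i → h i j))      ∎
  where open ≡-Reasoning

sumF-permute : ∀ {k} (σ τ : Fin k → Fin k) → (∀ i → σ (τ i) ≡ i) → (∀ i → τ (σ i) ≡ i) →
               ∀ f → sumF (f ∘ σ) ≡ sumF f
sumF-permute σ τ στ τσ f = trans (sumF≡sum (f ∘ σ))
  (trans (sym (ΣP.sum-permute f (permutation σ τ στ τσ))) (sym (sumF≡sum f)))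

count≡sumF : ∀ {k} (f : Fin k → Bool) → count f ≡ sumF (𝟙 ∘ f)
count≡sumF {zero}  f = refl
count≡sumF {suc k} f = cong (𝟙 (f zero) +_) (count≡sumF (f ∘ suc))

count-cong : ∀ {k} {f g : Fin k → Bool} → (∀ i → f i ≡ g i) → count f ≡ count g
count-cong {f = f} {g} eq =
  trans (count≡sumF f) (trans (sumF-cong (cong 𝟙 ∘ eq)) (sym (count≡sumF g)))

𝟙-mono : ∀ {a b} → (a ≡ true → b ≡ true) → 𝟙 a ≤ 𝟙 b
𝟙-mono {false} _   = z≤n
𝟙-mono {true}  a⇒b rewrite a⇒b refl = ℕP.≤-refl

count-mono : ∀ {k} {f g : Fin k → Bool} → (∀ i → f i ≡ true → g i ≡ true) → count f ≤ count g
count-mono {zero}  _   = z≤n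
count-mono {suc k} f⇒g = +-mono-≤ (𝟙-mono (f⇒g zero)) (count-mono (f⇒g ∘ suc))

count-none : ∀ {k} {f : Fin k → Bool} → (∀ i → f i ≢ true) → count f ≡ 0
count-none {zero}          _    = refl
count-none {suc k} {f} none with f zero in f0
... | true  = ⊥-elim (none zero f0)
... | false = count-none (none ∘ suc)

count-witness : ∀ {k} (f : Fin k → Bool) → count f ≡ 0 ⊎ ∃ λ i → f i ≡ true
count-witness {zero}  f = inj₁ refl
count-witness {suc k} f with f zero in f0
... | true  = inj₂ (zero , f0)
... | false = Sum.map id (λ { (i , fi) → suc i , fi }) (count-witness (f ∘ suc))

count≥1 : ∀ {k} (f : Fin k → Bool) i → f i ≡ true → 1 ≤ count f
count≥1 f i fi = begin
  1               ≡⟨ cong 𝟙 (sym fi) ⟩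
  𝟙 (f i)         ≤⟨ term≤sumF (𝟙 ∘ f) i ⟩
  sumF (𝟙 ∘ f)    ≡⟨ sym (count≡sumF f) ⟩
  count f         ∎
  where open ≤-Reasoning

count-split : ∀ {k} (f g : Fin k → Bool) →
              count f ≡ count (λ i → f i ∧ g i) + count (λ i → f i ∧ not (g i))
count-split {zero}  f g = refl
count-split {suc k} f g with f zero | g zero
... | false | _     = count-split (f ∘ suc) (g ∘ suc)
... | true  | true  = cong suc (count-split (f ∘ suc) (g ∘ suc))
... | true  | false = trans (cong suc (count-split (f ∘ suc) (g ∘ suc))) (sym (ℕP.+-suc _ _))

count-all : ∀ {k} → count {k} (λ _ → true) ≡ k
count-all {zero}  = refl
count-all {suc k} = cong suc (count-all {k})

count-∨ : ∀ {k} (f g : Fin k → Bool) → count (λ i → f i ∨ g i) ≤ count f + count g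
count-∨ {zero}  f g = z≤n
count-∨ {suc k} f g = begin
  𝟙 (f zero ∨ g zero) + count (λ i → f (suc i) ∨ g (suc i))
    ≤⟨ +-mono-≤ (𝟙-∨ (f zero) (g zero)) (count-∨ (f ∘ suc) (g ∘ suc)) ⟩
  (𝟙 (f zero) + 𝟙 (g zero)) + (count (f ∘ suc) + count (g ∘ suc))
    ≡⟨ ℕ-interchange (𝟙 (f zero)) (𝟙 (g zero)) _ _ ⟩
  count f + count g ∎
  where
  open ≤-Reasoning
  𝟙-∨ : ∀ a b → 𝟙 (a ∨ b) ≤ 𝟙 a + 𝟙 b
  𝟙-∨ true  _ = s≤s z≤n
  𝟙-∨ false _ = ℕP.≤-refl

count-≟ : ∀ {k} (a : Fin k) → count (λ z → ⌊ z ≟ a ⌋) ≡ 1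
count-≟ {suc k} zero    = cong suc (count-none {k} (λ _ ()))
count-≟ {suc k} (suc a) =
  trans (count-cong (λ i → ⌊⌋-map′ (cong suc) suc-injective (i ≟ a))) (count-≟ a)

count≤1 : ∀ {k} (f : Fin k → Bool) → (∀ i j → f i ≡ true → f j ≡ true → i ≡ j) → count f ≤ 1
count≤1 f unique with count-witness f
... | inj₁ none     = ≤-trans (≤-reflexive none) z≤n
... | inj₂ (w , fw) = ≤-trans (count-mono (λ i fi → ⌊⌋-true (i ≟ w) (unique i w fi fw)))
                               (≤-reflexive (count-≟ w))

count≥2 : ∀ {k} (f : Fin k → Bool) a b → f a ≡ true → f b ≡ true → a ≢ b → 2 ≤ count f
count≥2 f a b fa fb a≢b = begin
  1 + 1 ≤⟨ +-mono-≤ (count≥1 _ a (∧-intro fa (⌊⌋-true (a ≟ a) refl)))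
                    (count≥1 _ b (∧-intro fb (cong not (⌊⌋-false (b ≟ a) (a≢b ∘ sym))))) ⟩
  count (λ i → f i ∧ ⌊ i ≟ a ⌋) + count (λ i → f i ∧ not ⌊ i ≟ a ⌋) ≡⟨ sym (count-split f _) ⟩
  count f ∎
  where open ≤-Reasoning

count-compl : ∀ {k} (f : Fin k → Bool) → count f + count (not ∘ f) ≡ k
count-compl f = trans (sym (count-split (λ _ → true) f)) count-all

countPairs-swap : ∀ {k} (Q : Fin k → Fin k → Bool) → countPairs Q ≡ countPairs (λ z y → Q y z)
countPairs-swap Q = trans (sumF-cong (count≡sumF ∘ Q))
  (trans (sumF-swap (λ y z → 𝟙 (Q y z))) (sym (sumF-cong (λ z → count≡sumF (λ y → Q y z)))))

countPairs≡0 : ∀ {k} {P : Fin k → Fin k → Bool} → countPairs P ≡ 0 → ∀ y z → P y z ≢ true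
countPairs≡0 {P = P} none y z pyz with () ← ≤-trans (≤-trans (count≥1 (P y) z pyz)
  (term≤sumF (λ u → count (P u)) y)) (≤-reflexive none)

handshake : ∀ {k} (Q : Fin k → Fin k → Bool) → (∀ y z → Q y z ≡ Q z y) →
            countPairs (λ y z → not ⌊ y ≟ z ⌋ ∧ Q y z) ≤ 2 * countPairs (λ y z → ⌊ y <? z ⌋ ∧ Q y z)
handshake Q Q-sym = begin
  countPairs (λ y z → not ⌊ y ≟ z ⌋ ∧ Q y z)
    ≤⟨ sumF-mono (λ y → count-mono (ordered y)) ⟩
  sumF (λ y → count (λ z → D y z ∨ D z y))
    ≤⟨ sumF-mono (λ y → count-∨ (D y) (λ z → D z y)) ⟩
  sumF (λ y → count (D y) + count (λ z → D z y))
    ≡⟨ sumF-+ (count ∘ D) (λ y → count (λ z → D z y)) ⟩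
  countPairs D + countPairs (λ y z → D z y)
    ≡⟨ cong₂ _+_ refl (trans (sym (countPairs-swap D)) (sym (ℕP.+-identityʳ _))) ⟩
  2 * countPairs D ∎
  where
  open ≤-Reasoning
  D : _ → _ → Bool
  D y z = ⌊ y <? z ⌋ ∧ Q y z
  ordered : ∀ y z → not ⌊ y ≟ z ⌋ ∧ Q y z ≡ true → D y z ∨ D z y ≡ true
  ordered y z h with <-cmp y z
  ... | tri< y<z _ _ = ∨-introˡ (∧-intro (⌊⌋-true (y <? z) y<z) (∧-elimʳ (not ⌊ y ≟ z ⌋) h))
  ... | tri> _ _ z<y = ∨-introʳ (D y z)
                         (∧-intro (⌊⌋-true (z <? y) z<y) (trans (sym (Q-sym y z)) (∧-elimʳ (not ⌊ y ≟ z ⌋) h)))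
  ... | tri≈ _ y≡z _ = ⊥-elim (true≢false
                         (trans (sym (∧-elimˡ (not ⌊ y ≟ z ⌋) h)) (cong not (⌊⌋-true (y ≟ z) y≡z))))

∣∣≡count : ∀ {k} (p : Subset k) → ∣ p ∣ ≡ count (lookup p)
∣∣≡count []          = refl
∣∣≡count (true  ∷ p) = cong suc (∣∣≡count p)
∣∣≡count (false ∷ p) = ∣∣≡count p

complement-size : ∀ {n} (E : Subset (2 * n)) → ∣ E ∣ ≡ n → count (not ∘ lookup E) ≡ n
complement-size {n} E ∣E∣≡n = ℕP.+-cancelˡ-≡ n _ _ (begin
  n + count (not ∘ lookup E)                 ≡⟨ cong (_+ count (not ∘ lookup E)) (sym ∣E∣≡n) ⟩
  ∣ E ∣ + count (not ∘ lookup E)             ≡⟨ cong (_+ count (not ∘ lookup E)) (∣∣≡count E) ⟩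
  count (lookup E) + count (not ∘ lookup E)  ≡⟨ count-compl (lookup E) ⟩
  n + (n + 0)                                ≡⟨ cong (n +_) (ℕP.+-identityʳ n) ⟩
  n + n                                      ∎)
  where open ≡-Reasoning

lookup-⊤ : ∀ {k} (w : Fin k) → lookup ⊤ w ≡ true
lookup-⊤ w = []=⇒lookup (∈⊤ {x = w})

⁅⁆-intro : ∀ {k} {x w : Fin k} → w ≡ x → lookup ⁅ x ⁆ w ≡ true
⁅⁆-intro {x = x} refl = []=⇒lookup (x∈⁅x⁆ x)

⁅⁆-elim : ∀ {k} {x w : Fin k} → lookup ⁅ x ⁆ w ≡ true → w ≡ x
⁅⁆-elim {x = x} {w} h = x∈⁅y⁆⇒x≡y x (lookup⇒[]= w ⁅ x ⁆ h)

⁅⁆-⊆ : ∀ {k} (S : Subset k) {x} → lookup S x ≡ true → ∀ w → lookup ⁅ x ⁆ w ≡ true → lookup S w ≡ true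
⁅⁆-⊆ S Sx w h = subst (λ v → lookup S v ≡ true) (sym (⁅⁆-elim h)) Sx

module OnAbelianGroup {N : ℕ} (_⊕_ : Op₂ (Fin N)) (0g : Fin N) (⊖_ : Op₁ (Fin N))
                      (isAG : IsAbelianGroup _≡_ _⊕_ 0g ⊖_) where

  abelianGroup : AbelianGroup 0ℓ 0ℓ
  abelianGroup = record { isAbelianGroup = isAG }

  open AbelianGroup abelianGroup using (comm; identityˡ; inverseʳ; commutativeSemigroup)
  open AbelianGroupProperties abelianGroup
    using (∙-cancelˡ; ⁻¹-involutive; ε⁻¹≈ε; inverseʳ-unique; identityˡ-unique;
           identityʳ-unique; ⁻¹-anti-homo‿-; //-rightDividesˡ; //-rightDividesʳ)
  open CommutativeSemigroupProperties commutativeSemigroup using (interchange)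
  open GraphDefs _⊕_ ⊖_

  sub-add : ∀ a b → (a -' b) ⊕ b ≡ a
  sub-add a b = //-rightDividesˡ b a

  add-sub : ∀ a b → (a ⊕ b) -' b ≡ a
  add-sub a b = //-rightDividesʳ b a

  add-diff : ∀ y x → y ⊕ (x -' y) ≡ x
  add-diff y x = trans (comm y (x -' y)) (sub-add x y)

  neg-diff : ∀ y z → ⊖ (y -' z) ≡ z -' y
  neg-diff = ⁻¹-anti-homo‿-

  double≡0⇒self-inverse : ∀ t → t ⊕ t ≡ 0g → t ≡ ⊖ t
  double≡0⇒self-inverse t = inverseʳ-unique t t

  self-inverse⇒double≡0 : ∀ t → t ≡ ⊖ t → t ⊕ t ≡ 0g
  self-inverse⇒double≡0 t t≡-t = trans (cong (t ⊕_) t≡-t) (inverseʳ t)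

  -- The solutions of y + y = x are empty or a translate of {t : t = -t};
  -- in either case there are at most as many as self-inverse elements.
  halves≤self-inverses : ∀ x → count (λ y → ⌊ (y ⊕ y) ≟ x ⌋) ≤ count (λ t → ⌊ t ≟ ⊖ t ⌋)
  halves≤self-inverses x with count-witness (λ y → ⌊ (y ⊕ y) ≟ x ⌋)
  ... | inj₁ none = ≤-trans (≤-reflexive none) z≤n
  ... | inj₂ (y₀ , half) = ≤-reflexive (begin
    count (λ y → ⌊ (y ⊕ y) ≟ x ⌋)
      ≡⟨ sym (count-translate (λ y → ⌊ (y ⊕ y) ≟ x ⌋)) ⟩
    count (λ t → ⌊ ((t ⊕ y₀) ⊕ (t ⊕ y₀)) ≟ x ⌋)
      ≡⟨ count-cong (λ t → ⌊⌋-cong (((t ⊕ y₀) ⊕ (t ⊕ y₀)) ≟ x) (t ≟ ⊖ t) (to t) (from t)) ⟩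
    count (λ t → ⌊ t ≟ ⊖ t ⌋) ∎)
    where
    open ≡-Reasoning
    y₀+y₀≡x : y₀ ⊕ y₀ ≡ x
    y₀+y₀≡x = ⌊⌋-sound ((y₀ ⊕ y₀) ≟ x) half
    count-translate : ∀ f → count (λ t → f (t ⊕ y₀)) ≡ count f
    count-translate f = trans (count≡sumF (λ t → f (t ⊕ y₀))) (trans
      (sumF-permute (_⊕ y₀) (_-' y₀) (λ t → sub-add t y₀) (λ t → add-sub t y₀) (𝟙 ∘ f))
      (sym (count≡sumF f)))
    shifted : ∀ t → (t ⊕ y₀) ⊕ (t ⊕ y₀) ≡ (t ⊕ t) ⊕ x
    shifted t = trans (interchange t y₀ t y₀) (cong ((t ⊕ t) ⊕_) y₀+y₀≡x)
    to : ∀ t → (t ⊕ y₀) ⊕ (t ⊕ y₀) ≡ x → t ≡ ⊖ t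
    to t eq = double≡0⇒self-inverse t (identityˡ-unique (t ⊕ t) x (trans (sym (shifted t)) eq))
    from : ∀ t → t ≡ ⊖ t → (t ⊕ y₀) ⊕ (t ⊕ y₀) ≡ x
    from t t≡-t = trans (shifted t)
      (trans (cong (_⊕ x) (self-inverse⇒double≡0 t t≡-t)) (identityˡ x))

  r⊤≡self-inverses : r ⊤ ≡ count (λ t → ⌊ t ≟ ⊖ t ⌋)
  r⊤≡self-inverses = count-cong (λ t → cong (_∧ ⌊ t ≟ ⊖ t ⌋) (lookup-⊤ t))

  adj-sum : ∀ S y z → lookup S (y ⊕ z) ≡ true → adj S y z ≡ true
  adj-sum S y z = ∨-introˡ

  adj-diff : ∀ S y z → lookup S (y -' z) ≡ true → adj S y z ≡ true
  adj-diff S y z = ∨-introʳ (lookup S (y ⊕ z)) ∘ ∨-introˡ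

  adj-rdiff : ∀ S y z → lookup S (z -' y) ≡ true → adj S y z ≡ true
  adj-rdiff S y z = ∨-introʳ (lookup S (y ⊕ z)) ∘ ∨-introʳ (lookup S (y -' z))

  adj-elim : ∀ S y z → adj S y z ≡ true →
             lookup S (y ⊕ z) ≡ true ⊎ lookup S (y -' z) ≡ true ⊎ lookup S (z -' y) ≡ true
  adj-elim S y z = Sum.map₂ (∨-elim (lookup S (y -' z))) ∘ ∨-elim (lookup S (y ⊕ z))

  adj-sym : ∀ S y z → adj S y z ≡ adj S z y
  adj-sym S y z = cong₂ _∨_ (cong (lookup S) (comm y z)) (∨-comm (lookup S (y -' z)) _)

  adj-mono : ∀ S T → (∀ w → lookup S w ≡ true → lookup T w ≡ true) →
             ∀ y z → adj S y z ≡ true → adj T y z ≡ true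
  adj-mono S T S⊆T y z h with adj-elim S y z h
  ... | inj₁ s        = adj-sum T y z (S⊆T _ s)
  ... | inj₂ (inj₁ d) = adj-diff T y z (S⊆T _ d)
  ... | inj₂ (inj₂ d) = adj-rdiff T y z (S⊆T _ d)

  adj-⁅⁆ : ∀ x y z → adj ⁅ x ⁆ y z ≡ true → x ≡ y ⊕ z ⊎ x ≡ y -' z ⊎ x ≡ z -' y
  adj-⁅⁆ x y z = Sum.map (sym ∘ ⁅⁆-elim) (Sum.map (sym ∘ ⁅⁆-elim) (sym ∘ ⁅⁆-elim)) ∘ adj-elim ⁅ x ⁆ y z

  PairFree : Subset N → Set
  PairFree S = ∀ u → lookup S u ≡ true → lookup S (⊖ u) ≡ true → u ≡ ⊖ u

  m≡0⇒pairFree : ∀ S → m S ≡ 0 → PairFree S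
  m≡0⇒pairFree S m≡0 u Su S-u with <-cmp u (⊖ u)
  ... | tri≈ _ u≡-u _ = u≡-u
  ... | tri< u<-u _ _ = ⊥-elim (countPairs≡0 m≡0 u (⊖ u)
        (∧-intro (⌊⌋-true (u <? ⊖ u) u<-u) (∧-intro (⌊⌋-true (⊖ u ≟ ⊖ u) refl) (∧-intro Su S-u))))
  ... | tri> _ _ -u<u = ⊥-elim (countPairs≡0 m≡0 (⊖ u) u
        (∧-intro (⌊⌋-true (⊖ u <? u) -u<u)
          (∧-intro (⌊⌋-true (u ≟ ⊖ (⊖ u)) (sym (⁻¹-involutive u))) (∧-intro S-u Su))))

  -- An edge {y , z} of G_S carries at most two labels x ∈ S: besides
  -- y + z, only one of the mutually inverse y - z, z - y can be in S.
  labels≤2 : ∀ S → PairFree S → ∀ y z →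
             count (λ x → lookup S x ∧ adj ⁅ x ⁆ y z) ≤ 2 * 𝟙 (adj S y z)
  labels≤2 S free y z with adj S y z in edgeS
  -- a label x ∈ S of {y , z} makes it an edge of G_S
  ... | false = ≤-reflexive (count-none (λ x h → true≢false (trans
        (sym (adj-mono ⁅ x ⁆ S (⁅⁆-⊆ S (∧-elimˡ (lookup S x) h)) y z (∧-elimʳ (lookup S x) h))) edgeS)))
  ... | true = begin
    count (λ x → lookup S x ∧ adj ⁅ x ⁆ y z)           ≤⟨ count-mono classify ⟩
    count (λ x → ⌊ x ≟ y ⊕ z ⌋ ∨ diffLabel x)          ≤⟨ count-∨ _ diffLabel ⟩
    count (λ x → ⌊ x ≟ y ⊕ z ⌋) + count diffLabel     ≤⟨ +-mono-≤ (≤-reflexive (count-≟ (y ⊕ z)))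
                                                                   (count≤1 diffLabel unique) ⟩
    1 + 1                                             ∎
    where
    open ≤-Reasoning
    diffLabel : Fin N → Bool
    diffLabel x = lookup S x ∧ (⌊ x ≟ y -' z ⌋ ∨ ⌊ x ≟ z -' y ⌋)
    classify : ∀ x → lookup S x ∧ adj ⁅ x ⁆ y z ≡ true → ⌊ x ≟ y ⊕ z ⌋ ∨ diffLabel x ≡ true
    classify x h with adj-⁅⁆ x y z (∧-elimʳ (lookup S x) h)
    ... | inj₁ s        = ∨-introˡ (⌊⌋-true (x ≟ y ⊕ z) s)
    ... | inj₂ (inj₁ d) = ∨-introʳ ⌊ x ≟ y ⊕ z ⌋
                            (∧-intro (∧-elimˡ (lookup S x) h) (∨-introˡ (⌊⌋-true (x ≟ y -' z) d)))
    ... | inj₂ (inj₂ d) = ∨-introʳ ⌊ x ≟ y ⊕ z ⌋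
                            (∧-intro (∧-elimˡ (lookup S x) h) (∨-introʳ ⌊ x ≟ y -' z ⌋ (⌊⌋-true (x ≟ z -' y) d)))
    inverse-labels : ∀ i j → lookup S i ≡ true → lookup S j ≡ true → j ≡ ⊖ i → i ≡ j
    inverse-labels i j Si Sj j≡-i =
      trans (free i Si (subst (λ v → lookup S v ≡ true) j≡-i Sj)) (sym j≡-i)
    which : ∀ i → diffLabel i ≡ true → i ≡ y -' z ⊎ i ≡ z -' y
    which i h = Sum.map (⌊⌋-sound (i ≟ y -' z)) (⌊⌋-sound (i ≟ z -' y))
                        (∨-elim ⌊ i ≟ y -' z ⌋ (∧-elimʳ (lookup S i) h))
    unique : ∀ i j → diffLabel i ≡ true → diffLabel j ≡ true → i ≡ j
    unique i j hi hj with which i hi | which j hj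
    ... | inj₁ i≡d | inj₁ j≡d = trans i≡d (sym j≡d)
    ... | inj₂ i≡r | inj₂ j≡r = trans i≡r (sym j≡r)
    ... | inj₁ i≡d | inj₂ j≡r = inverse-labels i j (∧-elimˡ (lookup S i) hi) (∧-elimˡ (lookup S j) hj)
          (trans j≡r (trans (sym (neg-diff y z)) (cong ⊖_ (sym i≡d))))
    ... | inj₂ i≡r | inj₁ j≡d = sym (inverse-labels j i (∧-elimˡ (lookup S j) hj) (∧-elimˡ (lookup S i) hi)
          (trans i≡r (trans (sym (neg-diff y z)) (cong ⊖_ (sym j≡d)))))

  edge : (E S : Subset N) → Fin N → Fin N → Bool
  edge E S y z = ⌊ y <? z ⌋ ∧ not (lookup E y) ∧ not (lookup E z) ∧ adj S y z

  labelled-edges : ∀ E S → PairFree S →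
                   sumF (λ x → if lookup S x then e E ⁅ x ⁆ else 0) ≤ 2 * e E S
  labelled-edges E S free = begin
    sumF (λ x → if lookup S x then e E ⁅ x ⁆ else 0)
      ≡⟨ sumF-cong expand ⟩
    sumF (λ x → sumF (λ y → sumF (λ z → labelled x y z)))
      ≡⟨ sumF-swap (λ x y → sumF (labelled x y)) ⟩
    sumF (λ y → sumF (λ x → sumF (λ z → labelled x y z)))
      ≡⟨ sumF-cong (λ y → sumF-swap (λ x z → labelled x y z)) ⟩
    sumF (λ y → sumF (λ z → sumF (λ x → labelled x y z)))
      ≡⟨ sumF-cong (λ y → sumF-cong (λ z → sym (count≡sumF (λ x → lookup S x ∧ edge E ⁅ x ⁆ y z)))) ⟩
    sumF (λ y → sumF (λ z → count (λ x → lookup S x ∧ edge E ⁅ x ⁆ y z)))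
      ≤⟨ sumF-mono (λ y → sumF-mono (guarded-labels y)) ⟩
    sumF (λ y → sumF (λ z → 2 * 𝟙 (edge E S y z)))
      ≡⟨ sumF-cong (λ y → sumF-* 2 (𝟙 ∘ edge E S y)) ⟩
    sumF (λ y → 2 * sumF (𝟙 ∘ edge E S y))
      ≡⟨ sumF-* 2 (λ y → sumF (𝟙 ∘ edge E S y)) ⟩
    2 * sumF (λ y → sumF (𝟙 ∘ edge E S y))
      ≡⟨ cong (2 *_) (sumF-cong (λ y → sym (count≡sumF (edge E S y)))) ⟩
    2 * e E S ∎
    where
    open ≤-Reasoning
    labelled : Fin N → Fin N → Fin N → ℕ
    labelled x y z = 𝟙 (lookup S x ∧ edge E ⁅ x ⁆ y z)
    expand : ∀ x → (if lookup S x then e E ⁅ x ⁆ else 0) ≡ sumF (λ y → sumF (labelled x y))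
    expand x with lookup S x
    ... | true  = sumF-cong (λ y → count≡sumF (edge E ⁅ x ⁆ y))
    ... | false = sym (trans (sumF-cong {N} {f = λ _ → sumF {N} (λ _ → 0)} (λ _ → sumF-zero {N})) (sumF-zero {N}))
    no-labels : count (λ x → lookup S x ∧ false) ≤ 0
    no-labels = ≤-reflexive (count-none (λ x → true≢false ∘ sym ∘ ∧-elimʳ (lookup S x)))
    guarded-labels : ∀ y z → count (λ x → lookup S x ∧ edge E ⁅ x ⁆ y z) ≤ 2 * 𝟙 (edge E S y z)
    guarded-labels y z with ⌊ y <? z ⌋ | lookup E y | lookup E z
    ... | true  | false | false = labels≤2 S free y z
    ... | false | _     | _     = no-labels
    ... | true  | true  | _     = no-labels
    ... | true  | false | true  = no-labels

  -- Part 1: a single x ∈ E, x ≠ 0.  Only that E is a subgroup is used;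
  -- the index enters through the size of O in the theorem.
  module OddVertices (E : Subset N) (sub : IsSubgroup _⊕_ 0g ⊖_ E) where
    open IsSubgroup sub

    Odd : Fin N → Set
    Odd y = lookup E y ≡ false

    odd⇒∉ : ∀ {y} → Odd y → y ∉ E
    odd⇒∉ oy y∈E = true≢false (trans (sym ([]=⇒lookup y∈E)) oy)

    ∉⇒odd : ∀ {y} → y ∉ E → Odd y
    ∉⇒odd {y} y∉E with lookup E y in ey
    ... | true  = ⊥-elim (y∉E (lookup⇒[]= y E ey))
    ... | false = refl

    odd-shift : ∀ {w y} → w ∈ E → Odd y → Odd (y ⊕ w)
    odd-shift {w} {y} w∈E oy = ∉⇒odd (λ y+w∈E →
      odd⇒∉ oy (subst (_∈ E) (add-sub y w) (+-closed y+w∈E (neg-closed w∈E))))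

    odd-neg : ∀ {y} → Odd y → Odd (⊖ y)
    odd-neg {y} oy = ∉⇒odd (λ -y∈E → odd⇒∉ oy (subst (_∈ E) (⁻¹-involutive y) (neg-closed -y∈E)))

    module Generator (x : Fin N) (x∈E : x ∈ E) (x≢0 : x ≢ 0g) where

      oddAdj : Fin N → Fin N → Bool
      oddAdj y z = not (lookup E y) ∧ not (lookup E z) ∧ adj ⁅ x ⁆ y z

      oddAdj-sym : ∀ y z → oddAdj y z ≡ oddAdj z y
      oddAdj-sym y z = trans
        (cong (λ a → not (lookup E y) ∧ not (lookup E z) ∧ a) (adj-sym ⁅ x ⁆ y z))
        (∧-swap (not (lookup E y)) (not (lookup E z)) _)

      Nbr : Fin N → Fin N → Bool
      Nbr y z = not ⌊ y ≟ z ⌋ ∧ oddAdj y z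

      deg : Fin N → ℕ
      deg y = count (Nbr y)

      Σdeg≤2e : sumF deg ≤ 2 * e E ⁅ x ⁆
      Σdeg≤2e = handshake oddAdj oddAdj-sym

      neighbour : ∀ {y z} → y ≢ z → Odd y → Odd z → adj ⁅ x ⁆ y z ≡ true → Nbr y z ≡ true
      neighbour {y} {z} y≢z oy oz yz = ∧-intro (cong not (⌊⌋-false (y ≟ z) y≢z))
        (∧-intro (cong not oy) (∧-intro (cong not oz) yz))

      -- y + x, y - x and x - y (the last unless y + y = x) are neighbours of
      -- an odd y; two of them coincide only if x = -x, resp. y = -y.
      module Neighbours (y : Fin N) (oy : Odd y) where

        nbr-sum : Nbr y (y ⊕ x) ≡ true
        nbr-sum = neighbour (λ eq → x≢0 (identityʳ-unique y x (sym eq))) oy (odd-shift x∈E oy)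
          (adj-rdiff ⁅ x ⁆ y (y ⊕ x) (⁅⁆-intro (trans (cong (_-' y) (comm y x)) (add-sub x y))))

        nbr-diff : Nbr y (y -' x) ≡ true
        nbr-diff = neighbour y≢y-x oy (odd-shift (neg-closed x∈E) oy)
          (adj-diff ⁅ x ⁆ y (y -' x) (⁅⁆-intro (trans (cong (y ⊕_) (neg-diff y x)) (add-diff y x))))
          where
          y≢y-x : y ≢ y -' x
          y≢y-x eq = x≢0 (trans (sym (⁻¹-involutive x))
            (trans (cong ⊖_ (identityʳ-unique y (⊖ x) (sym eq))) ε⁻¹≈ε))

        nbr-rdiff : (y ⊕ y) ≢ x → Nbr y (x -' y) ≡ true
        nbr-rdiff 2y≢x = neighbour (λ eq → 2y≢x (trans (cong (_⊕ y) eq) (sub-add x y))) oy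
          (subst Odd (comm (⊖ y) x) (odd-shift x∈E (odd-neg oy)))
          (adj-sum ⁅ x ⁆ y (x -' y) (⁅⁆-intro (add-diff y x)))

        sum≢diff : x ≢ ⊖ x → y ⊕ x ≢ y -' x
        sum≢diff x≢-x eq = x≢-x (∙-cancelˡ y x (⊖ x) eq)

        sum≢rdiff : y ≢ ⊖ y → y ⊕ x ≢ x -' y
        sum≢rdiff y≢-y eq = y≢-y (∙-cancelˡ x y (⊖ y) (trans (comm x y) eq))

      odd-degree≥2 : ∀ y → Odd y → 2 ≤ deg y + (𝟙 ⌊ y ≟ ⊖ y ⌋ + 𝟙 ⌊ (y ⊕ y) ≟ x ⌋)
      odd-degree≥2 y oy with x ≟ ⊖ x | y ≟ ⊖ y | (y ⊕ y) ≟ x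
      ... | no x≢-x | _       | _       = ≤-trans (count≥2 (Nbr y) _ _ nbr-sum nbr-diff (sum≢diff x≢-x)) (m≤m+n _ _)
        where open Neighbours y oy
      ... | yes _   | yes _   | _       = +-mono-≤ (count≥1 (Nbr y) _ (Neighbours.nbr-sum y oy)) (s≤s z≤n)
      ... | yes _   | no _    | yes _   = +-mono-≤ (count≥1 (Nbr y) _ (Neighbours.nbr-sum y oy)) (s≤s z≤n)
      ... | yes _   | no y≢-y | no 2y≢x =
            ≤-trans (count≥2 (Nbr y) _ _ nbr-sum (nbr-rdiff 2y≢x) (sum≢rdiff y≢-y)) (m≤m+n _ _)
        where open Neighbours y oy

      degree≥1 : ∀ y → 𝟙 (not (lookup E y)) ≤ deg y
      degree≥1 y = by-parity (lookup E y) refl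
        where
        by-parity : ∀ b → lookup E y ≡ b → 𝟙 (not b) ≤ deg y
        by-parity true  _  = z≤n
        by-parity false oy = count≥1 (Nbr y) (y ⊕ x) (Neighbours.nbr-sum y oy)

      degree≥2 : ∀ y → 2 * 𝟙 (not (lookup E y)) ≤ deg y + (𝟙 ⌊ y ≟ ⊖ y ⌋ + 𝟙 ⌊ (y ⊕ y) ≟ x ⌋)
      degree≥2 y = by-parity (lookup E y) refl
        where
        by-parity : ∀ b → lookup E y ≡ b → 2 * 𝟙 (not b) ≤ deg y + (𝟙 ⌊ y ≟ ⊖ y ⌋ + 𝟙 ⌊ (y ⊕ y) ≟ x ⌋)
        by-parity true  _  = z≤n
        by-parity false oy = odd-degree≥2 y oy

      odd≤2e : count (not ∘ lookup E) ≤ 2 * e E ⁅ x ⁆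
      odd≤2e = begin
        count (not ∘ lookup E)        ≡⟨ count≡sumF (not ∘ lookup E) ⟩
        sumF (𝟙 ∘ not ∘ lookup E)     ≤⟨ sumF-mono degree≥1 ⟩
        sumF deg                      ≤⟨ Σdeg≤2e ⟩
        2 * e E ⁅ x ⁆                 ∎
        where open ≤-Reasoning

      odd≤e+r : count (not ∘ lookup E) ≤ e E ⁅ x ⁆ + r ⊤
      odd≤e+r = ℕP.*-cancelˡ-≤ 2 (begin
        2 * count (not ∘ lookup E)
          ≡⟨ cong (2 *_) (count≡sumF (not ∘ lookup E)) ⟩
        2 * sumF (𝟙 ∘ not ∘ lookup E)
          ≡⟨ sym (sumF-* 2 (𝟙 ∘ not ∘ lookup E)) ⟩
        sumF (λ y → 2 * 𝟙 (not (lookup E y)))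
          ≤⟨ sumF-mono degree≥2 ⟩
        sumF (λ y → deg y + (selfInv y + half y))
          ≡⟨ trans (sumF-+ deg _) (cong (sumF deg +_) (sumF-+ selfInv half)) ⟩
        sumF deg + (sumF selfInv + sumF half)
          ≡⟨ cong (λ h → sumF deg + (sumF selfInv + h)) (sym (count≡sumF (λ y → ⌊ (y ⊕ y) ≟ x ⌋))) ⟩
        sumF deg + (sumF selfInv + count (λ y → ⌊ (y ⊕ y) ≟ x ⌋))
          ≤⟨ +-mono-≤ Σdeg≤2e (+-mono-≤ (≤-reflexive Σself≡r) (≤-trans (halves≤self-inverses x)
                                                                  (≤-reflexive (sym r⊤≡self-inverses)))) ⟩
        2 * e E ⁅ x ⁆ + (r ⊤ + r ⊤)
          ≡⟨ cong (λ t → 2 * e E ⁅ x ⁆ + (r ⊤ + t)) (sym (ℕP.+-identityʳ (r ⊤))) ⟩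
        2 * e E ⁅ x ⁆ + 2 * r ⊤
          ≡⟨ sym (ℕP.*-distribˡ-+ 2 (e E ⁅ x ⁆) (r ⊤)) ⟩
        2 * (e E ⁅ x ⁆ + r ⊤) ∎)
        where
        open ≤-Reasoning
        selfInv half : Fin N → ℕ
        selfInv y = 𝟙 ⌊ y ≟ ⊖ y ⌋
        half y = 𝟙 ⌊ (y ⊕ y) ≟ x ⌋
        Σself≡r : sumF selfInv ≡ r ⊤
        Σself≡r = trans (sym (count≡sumF (λ y → ⌊ y ≟ ⊖ y ⌋))) (sym r⊤≡self-inverses)

      odd∸r≤e : count (not ∘ lookup E) ∸ r ⊤ ≤ e E ⁅ x ⁆
      odd∸r≤e = ℕP.m≤n+o⇒m∸n≤o _ (r ⊤) (≤-trans odd≤e+r (≤-reflexive (ℕP.+-comm (e E ⁅ x ⁆) (r ⊤))))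

mainTheorem8 : (n : ℕ) (_+_ : Op₂ (Fin (2 * n))) (0g : Fin (2 * n)) (-_ : Op₁ (Fin (2 * n))) →
    IsAbelianGroup _≡_ _+_ 0g -_ →
    (E : Subset (2 * n)) → IsSubgroup _+_ 0g -_ E → ∣ E ∣ ≡ n →
    let open GraphDefs _+_ -_ in
    ((x : Fin (2 * n)) → x ∈ E → x ≢ 0g →
       (n ∸ r ⊤ ≤ e E ⁅ x ⁆) × (n ≤ 2 * e E ⁅ x ⁆))
    ×
    ((S : Subset (2 * n)) → S ⊆ E → 0g ∉ S → m S ≡ 0 →
       sumF (λ x → if lookup S x then e E ⁅ x ⁆ else 0) ≤ 2 * e E S)
mainTheorem8 n _+_ 0g -_ isAG E sub ∣E∣≡n =
  (λ x x∈E x≢0 → let open Generator x x∈E x≢0 in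
     subst (λ o → o ∸ r ⊤ ≤ e E ⁅ x ⁆) odd≡n odd∸r≤e ,
     subst (_≤ 2 * e E ⁅ x ⁆) odd≡n odd≤2e) ,
  (λ S _ _ m≡0 → labelled-edges E S (m≡0⇒pairFree S m≡0))
  where
  open GraphDefs _+_ -_
  open OnAbelianGroup _+_ 0g -_ isAG
  open OddVertices E sub
  odd≡n : count (not ∘ lookup E) ≡ n
  odd≡n = complement-size E ∣E∣≡n
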